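{- The containment relation $\leq$ is a preorder on any set of components. Moreover, if $\mathcal{C}$ is a set of components such that for every component $A=(E_A,L_A)\in\mathcal{C}$ and any two TESs $\sigma,\tau\in L_A$, $\sigma\leq\tau$ implies $\sigma=\tau$, then $\leq$ is a partial order on $\mathcal{C}$.
   Context: A timed-event stream (TES) over a set of events $E$ is an infinite sequence $\sigma$ with $\sigma(i)=(O_i,t_i)$, $O_i\subseteq E$, $t_i\in\mathbb{R}_+$, $t_i<t_{i+1}$, non-Zeno; write $\mathrm{pr}_1(\sigma)(i)=O_i$, $\mathrm{pr}_2(\sigma)(i)=t_i$, and $\mathrm{TES}(E)$ for all TESs over $E$. A component is a pair $(E,L)$ with $E$ a set of events and $L\subseteq\mathrm{TES}(E)$; components are equal iff interfaces and behaviors are equal. For TESs, $\sigma\leq\tau$ iff $\mathrm{pr}_1(\sigma)(i)\subseteq\mathrm{pr}_1(\tau)(i)$ for all $i\in\mathbb{N}$ and $\mathrm{pr}_2(\sigma)=\mathrm{pr}_2(\tau)$. For components, $(E_A,L_A)\leq(E_B,L_B)$ iff $E_A\subseteq E_B$ and for every $\sigma\in L_A$ there exists $\tau\in L_B$ with $\sigma\leq\tau$. -}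

module Defs where

open import Level using (0ℓ)
open import Data.Nat using (ℕ; suc)
open import Data.Product using (Σ; ∃; _×_; _,_; proj₁)
open import Relation.Unary using (Pred; _⊆_; _∈_)
open import Relation.Binary.Core using (Rel)
open import Relation.Binary.PropositionalEquality using (_≡_)
open import Relation.Binary.Structures using (IsPreorder; IsPartialOrder)
open import Function.Base using (_on_)

module TimedEvents (Ev : Set) (T : Set) (_<_ : Rel T 0ℓ) where

  EventSet : Set₁
  EventSet = Pred Ev 0ℓ

  _≐_ : EventSet → EventSet → Set
  A ≐ B = (A ⊆ B) × (B ⊆ A)

  record TES (E : EventSet) : Set₁ where
    field
      obs     : ℕ → EventSet
      time    : ℕ → T
      obs⊆E   : ∀ i → obs i ⊆ E
      incr    : ∀ i → time i < time (suc i)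
      nonZeno : ∀ (t : T) → ∃ λ i → t < time i
  open TES public

  _≤ₜ_ : ∀ {E F} → TES E → TES F → Set
  σ ≤ₜ τ = (∀ i → obs σ i ⊆ obs τ i) × (∀ i → time σ i ≡ time τ i)

  _≈ₜ_ : ∀ {E F} → TES E → TES F → Set
  σ ≈ₜ τ = (∀ i → obs σ i ≐ obs τ i) × (∀ i → time σ i ≡ time τ i)

  record Component : Set₁ where
    constructor ⟨_,_⟩
    field
      iface : EventSet
      beh   : Pred (TES iface) 0ℓ
  open Component public

  _⊆L_ : Component → Component → Set₁
  A ⊆L B = ∀ σ → σ ∈ beh A → ∃ λ τ → τ ∈ beh B × σ ≈ₜ τ

  _≈C_ : Rel Component (Level.suc 0ℓ)
  A ≈C B = (iface A ≐ iface B) × (A ⊆L B) × (B ⊆L A)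

  _≤C_ : Rel Component (Level.suc 0ℓ)
  A ≤C B = (iface A ⊆ iface B) × (∀ σ → σ ∈ beh A → ∃ λ τ → τ ∈ beh B × σ ≤ₜ τ)

  TESAntisym : Pred Component 0ℓ → Set₁
  TESAntisym 𝒞 = ∀ A → A ∈ 𝒞 → ∀ (σ τ : TES (iface A)) →
                 σ ∈ beh A → τ ∈ beh A → σ ≤ₜ τ → σ ≈ₜ τ

  -- the relations restricted to the elements of 𝒞
  Sub : Pred Component 0ℓ → Set₁
  Sub 𝒞 = Σ Component (λ A → A ∈ 𝒞)

{-# OPTIONS --safe #-}
module Submission where

open import Defs
open import Level using (0ℓ)
open import Data.Product using (_×_; proj₁; _,_)
open import Relation.Binary.Core using (Rel)
open import Relation.Binary.Structures using (IsPreorder; IsPartialOrder; IsEquivalence)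
open import Relation.Binary.Construct.On as On using ()
open import Relation.Unary using (Pred; _∈_)
open import Relation.Unary.Properties using (⊆-trans; ⊆-antisym; ≐-refl; ≐-sym; ≐-trans)
open import Relation.Binary.PropositionalEquality using (refl; sym; trans)
open import Function.Base using (_on_)

module ComponentOrder (Ev : Set) (T : Set) (_<_ : Rel T 0ℓ) where
  open TimedEvents Ev T _<_

  -- _≈ₜ_ and _≤ₜ_ see streams only through obs and time, so the streams
  -- cannot be inferred from them and are passed explicitly below.
  ≈ₜ-refl : ∀ {E} {σ : TES E} → σ ≈ₜ σ
  ≈ₜ-refl = (λ _ → ≐-refl) , (λ _ → refl)

  ≈ₜ-sym : ∀ {E F} {σ : TES E} {τ : TES F} → σ ≈ₜ τ → τ ≈ₜ σ
  ≈ₜ-sym (obs≐ , time≡) = (λ i → ≐-sym (obs≐ i)) , (λ i → sym (time≡ i))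

  ≈ₜ-trans : ∀ {E F G} {σ : TES E} {τ : TES F} {ρ : TES G} →
             σ ≈ₜ τ → τ ≈ₜ ρ → σ ≈ₜ ρ
  ≈ₜ-trans {σ = σ} {τ} {ρ} (obs≐ , time≡) (obs≐′ , time≡′) =
    (λ i → ≐-trans {i = obs σ i} {obs τ i} {obs ρ i} (obs≐ i) (obs≐′ i)) ,
    (λ i → trans (time≡ i) (time≡′ i))

  ≈ₜ⇒≤ₜ : ∀ {E F} {σ : TES E} {τ : TES F} → σ ≈ₜ τ → σ ≤ₜ τ
  ≈ₜ⇒≤ₜ (obs≐ , time≡) = (λ i → proj₁ (obs≐ i)) , time≡

  ≤ₜ-trans : ∀ {E F G} {σ : TES E} {τ : TES F} {ρ : TES G} →
             σ ≤ₜ τ → τ ≤ₜ ρ → σ ≤ₜ ρ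
  ≤ₜ-trans {σ = σ} {τ} {ρ} (obs⊆ , time≡) (obs⊆′ , time≡′) =
    (λ i → ⊆-trans {i = obs σ i} {obs τ i} {obs ρ i} (obs⊆ i) (obs⊆′ i)) ,
    (λ i → trans (time≡ i) (time≡′ i))

  ≤ₜ-antisym : ∀ {E F} {σ : TES E} {τ : TES F} → σ ≤ₜ τ → τ ≤ₜ σ → σ ≈ₜ τ
  ≤ₜ-antisym (obs⊆ , time≡) (obs⊇ , _) = (λ i → ⊆-antisym (obs⊆ i) (obs⊇ i)) , time≡

  ⊆L-refl : ∀ {A} → A ⊆L A
  ⊆L-refl σ σ∈A = σ , σ∈A , ≈ₜ-refl {σ = σ}

  ⊆L-trans : ∀ {A B C} → A ⊆L B → B ⊆L C → A ⊆L C
  ⊆L-trans A⊆B B⊆C σ σ∈A =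
    let τ , τ∈B , σ≈τ = A⊆B σ σ∈A
        ρ , ρ∈C , τ≈ρ = B⊆C τ τ∈B
    in ρ , ρ∈C , ≈ₜ-trans {σ = σ} {τ} {ρ} σ≈τ τ≈ρ

  ≈C-isEquivalence : IsEquivalence _≈C_
  ≈C-isEquivalence = record
    { refl  = ≐-refl , ⊆L-refl , ⊆L-refl
    ; sym   = λ (E≐ , A⊆B , B⊆A) → ≐-sym E≐ , B⊆A , A⊆B
    ; trans = λ (E≐ , A⊆B , B⊆A) (E≐′ , B⊆C , C⊆B) →
                ≐-trans E≐ E≐′ , ⊆L-trans A⊆B B⊆C , ⊆L-trans C⊆B B⊆A
    }

  ≈C⇒≤C : ∀ {A B} → A ≈C B → A ≤C B
  ≈C⇒≤C (E≐ , A⊆B , _) = proj₁ E≐ , λ σ σ∈A →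
    let τ , τ∈B , σ≈τ = A⊆B σ σ∈A in τ , τ∈B , ≈ₜ⇒≤ₜ {σ = σ} {τ} σ≈τ

  ≤C-trans : ∀ {A B C} → A ≤C B → B ≤C C → A ≤C C
  ≤C-trans {A} {B} {C} (E⊆ , A≤B) (E⊆′ , B≤C) =
    ⊆-trans {i = iface A} {iface B} {iface C} E⊆ E⊆′ , λ σ σ∈A →
    let τ , τ∈B , σ≤τ = A≤B σ σ∈A
        ρ , ρ∈C , τ≤ρ = B≤C τ τ∈B
    in ρ , ρ∈C , ≤ₜ-trans {σ = σ} {τ} {ρ} σ≤τ τ≤ρ

  ≤C-isPreorder : IsPreorder _≈C_ _≤C_
  ≤C-isPreorder = record
    { isEquivalence = ≈C-isEquivalence
    ; reflexive     = ≈C⇒≤C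
    ; trans         = ≤C-trans
    }

  -- A stream σ of A lies below some τ of B, which lies below some σ′ of A; the
  -- hypothesis collapses σ ≤ σ′ to σ ≈ σ′, so τ ≤ σ′ ≈ σ and hence σ ≈ τ.
  ≤C-antisym⇒⊆L : ∀ {𝒞} → TESAntisym 𝒞 → ∀ {A B} → A ∈ 𝒞 →
                  A ≤C B → B ≤C A → A ⊆L B
  ≤C-antisym⇒⊆L antisymₜ {A} A∈𝒞 (_ , A≤B) (_ , B≤A) σ σ∈A =
    let τ , τ∈B , σ≤τ = A≤B σ σ∈A
        σ′ , σ′∈A , τ≤σ′ = B≤A τ τ∈B
        σ≈σ′ = antisymₜ A A∈𝒞 σ σ′ σ∈A σ′∈A (≤ₜ-trans {σ = σ} {τ} {σ′} σ≤τ τ≤σ′)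
        σ′≤σ = ≈ₜ⇒≤ₜ {σ = σ′} {σ} (≈ₜ-sym {σ = σ} {σ′} σ≈σ′)
    in τ , τ∈B , ≤ₜ-antisym {σ = σ} {τ} σ≤τ (≤ₜ-trans {σ = τ} {σ′} {σ} τ≤σ′ σ′≤σ)

  ≤C-isPartialOrder : ∀ 𝒞 → TESAntisym 𝒞 →
    IsPartialOrder {A = Sub 𝒞} (_≈C_ on proj₁) (_≤C_ on proj₁)
  ≤C-isPartialOrder 𝒞 antisymₜ = record
    { isPreorder = On.isPreorder proj₁ ≤C-isPreorder
    ; antisym    = λ { {A , A∈𝒞} {B , B∈𝒞} A≤B@(E⊆ , _) B≤A@(E⊇ , _) →
        ⊆-antisym E⊆ E⊇ ,
        ≤C-antisym⇒⊆L antisymₜ A∈𝒞 A≤B B≤A ,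
        ≤C-antisym⇒⊆L antisymₜ B∈𝒞 B≤A A≤B }
    }

lemma2 : (Ev : Set) (T : Set) (_<_ : Rel T 0ℓ) →
    let open TimedEvents Ev T _<_ in
    IsPreorder _≈C_ _≤C_ ×
    (∀ (𝒞 : Pred Component 0ℓ) → TESAntisym 𝒞 →
      IsPartialOrder {A = Sub 𝒞} (_≈C_ on proj₁) (_≤C_ on proj₁))
lemma2 Ev T _<_ = ≤C-isPreorder , ≤C-isPartialOrder
  where open ComponentOrder Ev T _<_
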